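{- For every integer $n\ge1$, as polynomials in $x,y$, $$\sum_{i=1}^n\sum_{j=0}^{n-2i+1} \frac{1}{n}\binom{n}{i}\binom{n-i}{j}\binom{n-i-j}{i-1} x^{i-1}y^{j}=\sum_{k=0}^{\lfloor(n-1)/2\rfloor} C_k \binom{n-1}{2k} x^k (1+y)^{n-2k-1},$$ where $C_k=\frac{1}{k+1}\binom{2k}{k}$ is the $k$-th Catalan number.
   Context: Binomial coefficients $\binom{a}{b}$ are $0$ when $b<0$ or $b>a$. -}

module Defs where

open import Data.Nat as ℕ using (ℕ; zero; suc; _∸_; _≤_)
open import Data.Nat.Combinatorics using (_C_)
open import Data.Integer using (+_)
open import Data.Rational using (ℚ; 0ℚ; 1ℚ; _+_; _*_; _/_)

sumFrom : ℕ → ℕ → (ℕ → ℚ) → ℚ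
sumFrom a zero    f = 0ℚ
sumFrom a (suc c) f = f a + sumFrom (suc a) c f

pow : ℚ → ℕ → ℚ
pow x zero    = 1ℚ
pow x (suc m) = x * pow x m

ι : ℕ → ℚ
ι m = + m / 1

catalan : ℕ → ℚ
catalan k = (+ 1 / suc k) * ι ((2 ℕ.* k) C k)

-- Left-hand side: sum_{i=1}^{n} sum_{j=0}^{n-2i+1} (1/n) C(n,i) C(n-i,j) C(n-i-j,i-1) x^(i-1) y^j
-- The inner range j = 0..n-2i+1 has (n+2) ∸ 2i terms (empty when n-2i+1 < 0).
lhs : (n : ℕ) → .{{ℕ.NonZero n}} → ℚ → ℚ → ℚ
lhs n x y =
  sumFrom 1 n (λ i →
    sumFrom 0 ((n ℕ.+ 2) ∸ (2 ℕ.* i)) (λ j →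
      (+ 1 / n) * ι (n C i) * ι ((n ∸ i) C j) * ι ((n ∸ i ∸ j) C (i ∸ 1))
        * pow x (i ∸ 1) * pow y j))

rhs : ℕ → ℚ → ℚ → ℚ
rhs n x y =
  sumFrom 0 (suc ((n ∸ 1) ℕ./ 2)) (λ k →
    catalan k * ι ((n ∸ 1) C (2 ℕ.* k)) * pow x k * pow (1ℚ + y) (n ∸ (2 ℕ.* k) ∸ 1))

-- With i = k + 1 and n = m + 1, each coefficient on the left factors through the absorption
-- identity (1/n) C(n, k+1) = (1/(k+1)) C(m, k) and the regrouping
-- C(m,k) C(m-k,j) C(m-k-j,k) = C(2k,k) C(m,2k) C(m-2k,j) of a four-part multinomial
-- coefficient, so that the (i, j)-term equals C_k C(m,2k) x^k C(m-2k,j) y^j.  Summing over j is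
-- then the binomial expansion of (1+y)^(m-2k), and the outer sum over k may stop at ⌊m/2⌋
-- because C(m,2k) vanishes beyond it.
module Submission where

open import Defs
open import Data.Nat using (ℕ; _≤_; >-nonZero)
open import Data.Rational using (ℚ)
open import Relation.Binary.PropositionalEquality using (_≡_)

open import Relation.Binary.PropositionalEquality
  using (refl; sym; trans; cong; cong₂; subst; subst₂; module ≡-Reasoning)

module _ where
  open import Data.Nat using (suc; _+_; _*_; _∸_; _<_; _!; _/_; s≤s; _≤?_)
  open import Data.Nat.Properties
  open import Data.Nat.Combinatorics using (_C_; nCk≡n!/k![n-k]!; k![n∸k]!∣n!; k>n⇒nCk≡0)
  open import Data.Nat.DivMod using (m/n*n≡m; m≡m%n+[m/n]*n; m%n<n)
  open import Data.Nat.Solver using (module +-*-Solver)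
  open import Relation.Nullary using (yes; no)
  open +-*-Solver using (solve; _:+_; _:*_; _:=_; con)
  open ≡-Reasoning

  [m+n]Cm*m!*n!≡[m+n]! : ∀ m n → ((m + n) C m) * (m ! * n !) ≡ (m + n) !
  [m+n]Cm*m!*n!≡[m+n]! m n = begin
    ((m + n) C m) * (m ! * n !)
      ≡⟨ cong (λ k → ((m + n) C m) * (m ! * k !)) (m+n∸m≡n m n) ⟨
    ((m + n) C m) * (m ! * (m + n ∸ m) !)
      ≡⟨ cong (_* (m ! * (m + n ∸ m) !)) (nCk≡n!/k![n-k]! (m≤m+n m n)) ⟩
    (m + n) ! / (m ! * (m + n ∸ m) !) * (m ! * (m + n ∸ m) !)
      ≡⟨ m/n*n≡m (k![n∸k]!∣n! (m≤m+n m n)) ⟩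
    (m + n) ! ∎
    where
    instance _ = m !* (m + n ∸ m) !≢0

  C-absorption : ∀ n k → suc k * (suc n C suc k) ≡ suc n * (n C k)
  C-absorption n k with k ≤? n
  ... | no k≰n rewrite k>n⇒nCk≡0 (≰⇒> k≰n) | k>n⇒nCk≡0 (s≤s (≰⇒> k≰n)) = trans (*-zeroʳ (suc k)) (sym (*-zeroʳ (suc n)))
  ... | yes k≤n = subst (λ n → suc k * (suc n C suc k) ≡ suc n * (n C k)) (m+[n∸m]≡n k≤n) (absorption k (n ∸ k))
    where
    absorption : ∀ k t → suc k * (suc (k + t) C suc k) ≡ suc (k + t) * ((k + t) C k)
    absorption k t = *-cancelʳ-≡ _ _ (k ! * t !) {{k !* t !≢0}} (begin
      suc k * (suc (k + t) C suc k) * (k ! * t !)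
        ≡⟨ solve 4 (λ k′ c f g → k′ :* c :* (f :* g) := c :* (k′ :* f :* g)) refl (suc k) (suc (k + t) C suc k) (k !) (t !) ⟩
      (suc (k + t) C suc k) * (suc k ! * t !)
        ≡⟨ [m+n]Cm*m!*n!≡[m+n]! (suc k) t ⟩
      suc (k + t) * (k + t) !
        ≡⟨ cong (suc (k + t) *_) ([m+n]Cm*m!*n!≡[m+n]! k t) ⟨
      suc (k + t) * (((k + t) C k) * (k ! * t !))
        ≡⟨ *-assoc (suc (k + t)) ((k + t) C k) (k ! * t !) ⟨
      suc (k + t) * ((k + t) C k) * (k ! * t !) ∎)

  C-regroup : ∀ a b c d →
    ((a + (b + (c + d))) C a) * ((b + (c + d)) C b) * ((c + d) C c)
    ≡ ((a + c) C a) * (((a + c) + (b + d)) C (a + c)) * ((b + d) C b)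
  C-regroup a b c d = *-cancelʳ-≡ _ _ (a ! * b ! * (c ! * d !)) {{nonZero}} (begin
    X₁ * X₂ * X₃ * (a ! * b ! * (c ! * d !))
      ≡⟨ solve 7 (λ x₁ x₂ x₃ a′ b′ c′ d′ → x₁ :* x₂ :* x₃ :* (a′ :* b′ :* (c′ :* d′)) := x₁ :* (a′ :* (x₂ :* (b′ :* (x₃ :* (c′ :* d′)))))) refl X₁ X₂ X₃ (a !) (b !) (c !) (d !) ⟩
    X₁ * (a ! * (X₂ * (b ! * (X₃ * (c ! * d !)))))
      ≡⟨ cong (λ z → X₁ * (a ! * (X₂ * (b ! * z)))) ([m+n]Cm*m!*n!≡[m+n]! c d) ⟩
    X₁ * (a ! * (X₂ * (b ! * (c + d) !)))
      ≡⟨ cong (λ z → X₁ * (a ! * z)) ([m+n]Cm*m!*n!≡[m+n]! b (c + d)) ⟩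
    X₁ * (a ! * (b + (c + d)) !)
      ≡⟨ [m+n]Cm*m!*n!≡[m+n]! a (b + (c + d)) ⟩
    (a + (b + (c + d))) !
      ≡⟨ cong _! (solve 4 (λ a b c d → a :+ (b :+ (c :+ d)) := (a :+ c) :+ (b :+ d)) refl a b c d) ⟩
    ((a + c) + (b + d)) !
      ≡⟨ [m+n]Cm*m!*n!≡[m+n]! (a + c) (b + d) ⟨
    Y₂ * ((a + c) ! * (b + d) !)
      ≡⟨ cong₂ (λ u v → Y₂ * (u * v)) ([m+n]Cm*m!*n!≡[m+n]! a c) ([m+n]Cm*m!*n!≡[m+n]! b d) ⟨
    Y₂ * ((Y₁ * (a ! * c !)) * (Y₃ * (b ! * d !)))
      ≡⟨ solve 7 (λ y₁ y₂ y₃ a′ b′ c′ d′ → y₂ :* ((y₁ :* (a′ :* c′)) :* (y₃ :* (b′ :* d′))) := y₁ :* y₂ :* y₃ :* (a′ :* b′ :* (c′ :* d′))) refl Y₁ Y₂ Y₃ (a !) (b !) (c !) (d !) ⟩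
    Y₁ * Y₂ * Y₃ * (a ! * b ! * (c ! * d !)) ∎)
    where
    X₁ = (a + (b + (c + d))) C a
    X₂ = (b + (c + d)) C b
    X₃ = (c + d) C c
    Y₁ = (a + c) C a
    Y₂ = ((a + c) + (b + d)) C (a + c)
    Y₃ = (b + d) C b
    nonZero = m*n≢0 (a ! * b !) (c ! * d !) {{a !* b !≢0}} {{c !* d !≢0}}

  nCk*[n∸k]Cj*[n∸k∸j]Ck≡[2k]Ck*nC[2k]*[n∸2k]Cj : ∀ n k j → 2 * k + j ≤ n →
    (n C k) * ((n ∸ k) C j) * ((n ∸ k ∸ j) C k) ≡ ((2 * k) C k) * (n C (2 * k)) * ((n ∸ 2 * k) C j)
  nCk*[n∸k]Cj*[n∸k∸j]Ck≡[2k]Ck*nC[2k]*[n∸2k]Cj n k j 2k+j≤n =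
    subst (λ n → (n C k) * ((n ∸ k) C j) * ((n ∸ k ∸ j) C k) ≡ ((2 * k) C k) * (n C (2 * k)) * ((n ∸ 2 * k) C j))
          n≡k+[j+[k+r]] (additive r)
    where
    r = n ∸ (2 * k + j)
    n≡k+[j+[k+r]] : k + (j + (k + r)) ≡ n
    n≡k+[j+[k+r]] = trans (solve 3 (λ k j r → k :+ (j :+ (k :+ r)) := con 2 :* k :+ j :+ r) refl k j r) (m+[n∸m]≡n 2k+j≤n)
    additive : ∀ r → let m = k + (j + (k + r)) in
      (m C k) * ((m ∸ k) C j) * ((m ∸ k ∸ j) C k) ≡ ((2 * k) C k) * (m C (2 * k)) * ((m ∸ 2 * k) C j)
    additive r = begin
      (m C k) * ((m ∸ k) C j) * ((m ∸ k ∸ j) C k)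
        ≡⟨ cong₂ (λ u v → (m C k) * (u C j) * (v C k)) m∸k≡j+[k+r] (trans (cong (_∸ j) m∸k≡j+[k+r]) (m+n∸m≡n j (k + r))) ⟩
      (m C k) * ((j + (k + r)) C j) * ((k + r) C k)
        ≡⟨ C-regroup k j k r ⟩
      ((k + k) C k) * (((k + k) + (j + r)) C (k + k)) * ((j + r) C j)
        ≡⟨ cong₂ (λ u v → (u C k) * (v C u) * ((j + r) C j)) 2k≡k+k m≡2k+[j+r] ⟨
      ((2 * k) C k) * (m C (2 * k)) * ((j + r) C j)
        ≡⟨ cong (λ u → ((2 * k) C k) * (m C (2 * k)) * (u C j)) m∸2k≡j+r ⟨
      ((2 * k) C k) * (m C (2 * k)) * ((m ∸ 2 * k) C j) ∎
      where
      m = k + (j + (k + r))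
      2k≡k+k : 2 * k ≡ k + k
      2k≡k+k = cong (k +_) (+-identityʳ k)
      m∸k≡j+[k+r] : m ∸ k ≡ j + (k + r)
      m∸k≡j+[k+r] = m+n∸m≡n k (j + (k + r))
      m≡2k+[j+r] : m ≡ (k + k) + (j + r)
      m≡2k+[j+r] = solve 3 (λ k j r → k :+ (j :+ (k :+ r)) := (k :+ k) :+ (j :+ r)) refl k j r
      m∸2k≡j+r : m ∸ 2 * k ≡ j + r
      m∸2k≡j+r = trans (cong₂ _∸_ m≡2k+[j+r] 2k≡k+k) (m+n∸m≡n (k + k) (j + r))

  [n+2]∸2[1+k]≡n∸2k : ∀ n k → n + 2 ∸ 2 * suc k ≡ n ∸ 2 * k
  [n+2]∸2[1+k]≡n∸2k n k = trans (cong₂ _∸_ (+-comm n 2) (*-suc 2 k)) ([m+n]∸[m+o]≡n∸o 2 n (2 * k))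

  m<2*[1+m/2] : ∀ m → m < 2 * suc (m / 2)
  m<2*[1+m/2] m = subst₂ _<_ (sym (m≡m%n+[m/n]*n m 2)) [2+q*2≡2*[1+q]] (+-monoˡ-< (m / 2 * 2) (m%n<n m 2))
    where
    [2+q*2≡2*[1+q]] : 2 + m / 2 * 2 ≡ 2 * suc (m / 2)
    [2+q*2≡2*[1+q]] = solve 1 (λ q → con 2 :+ q :* con 2 := con 2 :* (con 1 :+ q)) refl (m / 2)

open import Data.Nat as ℕ using (zero; suc; z≤n; s≤s; _<_; _∸_)
import Data.Nat.Properties as ℕ
open import Data.Nat.Combinatorics using (_C_; k>n⇒nCk≡0; nCk+nC[k+1]≡[n+1]C[k+1])
open import Data.Nat.Coprimality as Coprime using (1-coprimeTo)
open import Data.Nat.DivMod using (m/n≤m)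
open import Data.Integer as ℤ using (+_)
import Data.Integer.Properties as ℤ
open import Data.Rational using (_+_; _*_; _/_; 0ℚ; 1ℚ; mkℚ)
open import Data.Rational.Properties using (normalize-coprime; /-cong; *-inverseˡ; *-zeroˡ; *-zeroʳ; *-identityʳ; *-distribˡ-+; +-assoc)
open import Data.Rational.Solver using (module +-*-Solver)
open import Relation.Nullary using (yes; no)
open +-*-Solver using (solve; _:+_; _:*_; _:=_; con)
open ≡-Reasoning

ι≡mkℚ : ∀ m → ι m ≡ mkℚ (+ m) 0 (Coprime.sym (1-coprimeTo m))
ι≡mkℚ m = normalize-coprime (Coprime.sym (1-coprimeTo m))

ι-* : ∀ a b → ι (a ℕ.* b) ≡ ι a * ι b
ι-* a b rewrite ι≡mkℚ a | ι≡mkℚ b = sym (/-cong (ℤ.+◃n≡+n (a ℕ.* b)) refl)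

ι-+ : ∀ a b → ι (a ℕ.+ b) ≡ ι a + ι b
ι-+ a b rewrite ι≡mkℚ a | ι≡mkℚ b = sym (/-cong (cong₂ ℤ._+_ (ℤ.*-identityʳ (+ a)) (ℤ.*-identityʳ (+ b))) refl)

1/[1+n]*[1+n]≡1 : ∀ n → (+ 1 / suc n) * ι (suc n) ≡ 1ℚ
1/[1+n]*[1+n]≡1 n rewrite ι≡mkℚ (suc n) | normalize-coprime {1} {n} (1-coprimeTo (suc n)) =
  *-inverseˡ (mkℚ (+ suc n) 0 (Coprime.sym (1-coprimeTo (suc n))))

1/[1+p]*a≡1/[1+q]*b : ∀ p q a b → suc q ℕ.* a ≡ suc p ℕ.* b →
                      (+ 1 / suc p) * ι a ≡ (+ 1 / suc q) * ι b
1/[1+p]*a≡1/[1+q]*b p q a b [1+q]a≡[1+p]b = begin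
  P * ι a                        ≡⟨ *-identityʳ (P * ι a) ⟨
  P * ι a * 1ℚ                   ≡⟨ cong (P * ι a *_) (1/[1+n]*[1+n]≡1 q) ⟨
  P * ι a * (Q * ι (suc q))      ≡⟨ solve 4 (λ p a q q′ → p :* a :* (q :* q′) := p :* q :* (q′ :* a)) refl P (ι a) Q (ι (suc q)) ⟩
  P * Q * (ι (suc q) * ι a)      ≡⟨ cong (P * Q *_) (trans (sym (ι-* (suc q) a)) (trans (cong ι [1+q]a≡[1+p]b) (ι-* (suc p) b))) ⟩
  P * Q * (ι (suc p) * ι b)      ≡⟨ solve 4 (λ p q p′ b → p :* q :* (p′ :* b) := q :* b :* (p :* p′)) refl P Q (ι (suc p)) (ι b) ⟩
  Q * ι b * (P * ι (suc p))      ≡⟨ cong (Q * ι b *_) (1/[1+n]*[1+n]≡1 p) ⟩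
  Q * ι b * 1ℚ                   ≡⟨ *-identityʳ (Q * ι b) ⟩
  Q * ι b                        ∎
  where
  P = + 1 / suc p
  Q = + 1 / suc q

sumFrom-cong : ∀ a c {f g : ℕ → ℚ} → (∀ i → a ℕ.≤ i → i < a ℕ.+ c → f i ≡ g i) →
               sumFrom a c f ≡ sumFrom a c g
sumFrom-cong a zero    f≗g = refl
sumFrom-cong a (suc c) f≗g = cong₂ _+_
  (f≗g a ℕ.≤-refl (ℕ.m<m+n a ℕ.z<s))
  (sumFrom-cong (suc a) c (λ i a<i i<a+c → f≗g i (ℕ.<⇒≤ a<i) (ℕ.≤-trans i<a+c (ℕ.≤-reflexive (sym (ℕ.+-suc a c))))))

sumFrom-suc : ∀ a c (f : ℕ → ℚ) → sumFrom (suc a) c f ≡ sumFrom a c (λ i → f (suc i))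
sumFrom-suc a zero    f = refl
sumFrom-suc a (suc c) f = cong (_+_ (f (suc a))) (sumFrom-suc (suc a) c f)

*-distribˡ-sumFrom : ∀ q a c (f : ℕ → ℚ) → q * sumFrom a c f ≡ sumFrom a c (λ i → q * f i)
*-distribˡ-sumFrom q a zero    f = *-zeroʳ q
*-distribˡ-sumFrom q a (suc c) f =
  trans (*-distribˡ-+ q (f a) (sumFrom (suc a) c f)) (cong (_+_ (q * f a)) (*-distribˡ-sumFrom q (suc a) c f))

sumFrom-+ : ∀ a c (f g : ℕ → ℚ) → sumFrom a c (λ i → f i + g i) ≡ sumFrom a c f + sumFrom a c g
sumFrom-+ a zero    f g = refl
sumFrom-+ a (suc c) f g = begin
  f a + g a + sumFrom (suc a) c (λ i → f i + g i)
    ≡⟨ cong (_+_ (f a + g a)) (sumFrom-+ (suc a) c f g) ⟩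
  f a + g a + (sumFrom (suc a) c f + sumFrom (suc a) c g)
    ≡⟨ solve 4 (λ u v s t → u :+ v :+ (s :+ t) := u :+ s :+ (v :+ t)) refl (f a) (g a) (sumFrom (suc a) c f) (sumFrom (suc a) c g) ⟩
  f a + sumFrom (suc a) c f + (g a + sumFrom (suc a) c g) ∎

sumFrom-zero : ∀ a c (f : ℕ → ℚ) → (∀ i → a ℕ.≤ i → f i ≡ 0ℚ) → sumFrom a c f ≡ 0ℚ
sumFrom-zero a zero    f f≡0 = refl
sumFrom-zero a (suc c) f f≡0 =
  cong₂ _+_ (f≡0 a ℕ.≤-refl) (sumFrom-zero (suc a) c f (λ i a<i → f≡0 i (ℕ.<⇒≤ a<i)))

sumFrom-vanishing : ∀ a {h c} (f : ℕ → ℚ) → h ℕ.≤ c → (∀ i → a ℕ.+ h ℕ.≤ i → f i ≡ 0ℚ) →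
                    sumFrom a c f ≡ sumFrom a h f
sumFrom-vanishing a {zero} {c} f _ f≡0 =
  sumFrom-zero a c f (λ i a≤i → f≡0 i (ℕ.≤-trans (ℕ.≤-reflexive (ℕ.+-identityʳ a)) a≤i))
sumFrom-vanishing a {suc h} {suc c} f (s≤s h≤c) f≡0 =
  cong (_+_ (f a)) (sumFrom-vanishing (suc a) f h≤c (λ i 1+a+h≤i → f≡0 i (ℕ.≤-trans (ℕ.≤-reflexive (ℕ.+-suc a h)) 1+a+h≤i)))

binomialTerm : ℚ → ℕ → ℕ → ℚ
binomialTerm y m j = ι (m C j) * pow y j

binomialTerm-pascal : ∀ y m j →
  binomialTerm y m (suc j) + y * binomialTerm y m j ≡ binomialTerm y (suc m) (suc j)
binomialTerm-pascal y m j = begin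
  ι (m C suc j) * (y * pow y j) + y * (ι (m C j) * pow y j)
    ≡⟨ solve 4 (λ c c′ y p → c′ :* (y :* p) :+ y :* (c :* p) := (c :+ c′) :* (y :* p)) refl (ι (m C j)) (ι (m C suc j)) y (pow y j) ⟩
  (ι (m C j) + ι (m C suc j)) * (y * pow y j)
    ≡⟨ cong (_* (y * pow y j)) (trans (sym (ι-+ (m C j) (m C suc j))) (cong ι (nCk+nC[k+1]≡[n+1]C[k+1] m j))) ⟩
  ι (suc m C suc j) * (y * pow y j) ∎

binomialTerm-vanishes : ∀ y m j → m < j → binomialTerm y m j ≡ 0ℚ
binomialTerm-vanishes y m j m<j rewrite k>n⇒nCk≡0 m<j = *-zeroˡ (pow y j)

binomial-theorem : ∀ y m → pow (1ℚ + y) m ≡ sumFrom 0 (suc m) (binomialTerm y m)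
binomial-theorem y zero    = refl
binomial-theorem y (suc m) = begin
  (1ℚ + y) * pow (1ℚ + y) m
    ≡⟨ cong ((1ℚ + y) *_) (binomial-theorem y m) ⟩
  (1ℚ + y) * sumFrom 0 (suc m) b
    ≡⟨ solve 2 (λ y s → (con 1ℚ :+ y) :* s := s :+ y :* s) refl y (sumFrom 0 (suc m) b) ⟩
  sumFrom 0 (suc m) b + y * sumFrom 0 (suc m) b
    ≡⟨ cong₂ _+_ (sumFrom-vanishing 0 b (ℕ.n≤1+n (suc m)) (λ j → binomialTerm-vanishes y m j)) (sym (*-distribˡ-sumFrom y 0 (suc m) b)) ⟨
  b 0 + sumFrom 1 (suc m) b + sumFrom 0 (suc m) (λ j → y * b j)
    ≡⟨ cong (λ s → b 0 + s + sumFrom 0 (suc m) (λ j → y * b j)) (sumFrom-suc 0 (suc m) b) ⟩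
  b 0 + sumFrom 0 (suc m) (λ j → b (suc j)) + sumFrom 0 (suc m) (λ j → y * b j)
    ≡⟨ +-assoc (b 0) (sumFrom 0 (suc m) (λ j → b (suc j))) (sumFrom 0 (suc m) (λ j → y * b j)) ⟩
  b 0 + (sumFrom 0 (suc m) (λ j → b (suc j)) + sumFrom 0 (suc m) (λ j → y * b j))
    ≡⟨ cong (_+_ (b 0)) (sumFrom-+ 0 (suc m) (λ j → b (suc j)) (λ j → y * b j)) ⟨
  b 0 + sumFrom 0 (suc m) (λ j → b (suc j) + y * b j)
    ≡⟨ cong (_+_ (b 0)) (sumFrom-cong 0 (suc m) (λ j _ _ → binomialTerm-pascal y m j)) ⟩
  b 0 + sumFrom 0 (suc m) (λ j → binomialTerm y (suc m) (suc j))
    ≡⟨ cong (_+_ (b 0)) (sumFrom-suc 0 (suc m) (binomialTerm y (suc m))) ⟨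
  sumFrom 0 (suc (suc m)) (binomialTerm y (suc m)) ∎
  -- The last step holds by computation: m C 0 and suc m C 0 both reduce to 1.
  where
  b = binomialTerm y m

catalan-coefficient : ∀ {m} k j → 2 ℕ.* k ℕ.+ j ℕ.≤ m →
  (+ 1 / suc m) * ι (suc m C suc k) * ι ((m ∸ k) C j) * ι ((m ∸ k ∸ j) C k)
  ≡ catalan k * ι (m C (2 ℕ.* k)) * ι ((m ∸ 2 ℕ.* k) C j)
catalan-coefficient {m} k j 2k+j≤m = begin
  (+ 1 / suc m) * ι (suc m C suc k) * ι B * ι B′
    ≡⟨ cong (λ z → z * ι B * ι B′) (1/[1+p]*a≡1/[1+q]*b m k _ _ (C-absorption m k)) ⟩
  Q * ι (m C k) * ι B * ι B′
    ≡⟨ solve 4 (λ q a b b′ → q :* a :* b :* b′ := q :* (a :* b :* b′)) refl Q (ι (m C k)) (ι B) (ι B′) ⟩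
  Q * (ι (m C k) * ι B * ι B′)
    ≡⟨ cong (Q *_) (ι-*₃ (m C k) B B′) ⟨
  Q * ι ((m C k) ℕ.* B ℕ.* B′)
    ≡⟨ cong (λ z → Q * ι z) (nCk*[n∸k]Cj*[n∸k∸j]Ck≡[2k]Ck*nC[2k]*[n∸2k]Cj m k j 2k+j≤m) ⟩
  Q * ι (((2 ℕ.* k) C k) ℕ.* E ℕ.* G)
    ≡⟨ cong (Q *_) (ι-*₃ ((2 ℕ.* k) C k) E G) ⟩
  Q * (ι ((2 ℕ.* k) C k) * ι E * ι G)
    ≡⟨ solve 4 (λ q d e g → q :* (d :* e :* g) := q :* d :* e :* g) refl Q (ι ((2 ℕ.* k) C k)) (ι E) (ι G) ⟩
  catalan k * ι E * ι G ∎
  where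
  Q = + 1 / suc k
  B = (m ∸ k) C j
  B′ = (m ∸ k ∸ j) C k
  E = m C (2 ℕ.* k)
  G = (m ∸ 2 ℕ.* k) C j
  ι-*₃ : ∀ a b c → ι (a ℕ.* b ℕ.* c) ≡ ι a * ι b * ι c
  ι-*₃ a b c = trans (ι-* (a ℕ.* b) c) (cong (_* ι c) (ι-* a b))

lhsTerm : ℕ → ℚ → ℚ → ℕ → ℕ → ℚ
lhsTerm m x y i j =
  (+ 1 / suc m) * ι (suc m C i) * ι ((suc m ∸ i) C j) * ι ((suc m ∸ i ∸ j) C (i ∸ 1))
    * pow x (i ∸ 1) * pow y j

rhsTerm : ℕ → ℚ → ℚ → ℕ → ℚ
rhsTerm m x y k = catalan k * ι (m C (2 ℕ.* k)) * pow x k * pow (1ℚ + y) (suc m ∸ 2 ℕ.* k ∸ 1)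

lhsTerm-factor : ∀ m x y k j → 2 ℕ.* k ℕ.+ j ℕ.≤ m →
  lhsTerm m x y (suc k) j ≡ catalan k * ι (m C (2 ℕ.* k)) * pow x k * binomialTerm y (m ∸ 2 ℕ.* k) j
lhsTerm-factor m x y k j 2k+j≤m = begin
  (+ 1 / suc m) * ι (suc m C suc k) * ι ((m ∸ k) C j) * ι ((m ∸ k ∸ j) C k) * pow x k * pow y j
    ≡⟨ cong (λ c → c * pow x k * pow y j) (catalan-coefficient k j 2k+j≤m) ⟩
  catalan k * ι E * ι G * pow x k * pow y j
    ≡⟨ solve 5 (λ c e g x′ y′ → c :* e :* g :* x′ :* y′ := c :* e :* x′ :* (g :* y′)) refl (catalan k) (ι E) (ι G) (pow x k) (pow y j) ⟩
  catalan k * ι E * pow x k * (ι G * pow y j) ∎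
  where
  E = m C (2 ℕ.* k)
  G = (m ∸ 2 ℕ.* k) C j

rhsTerm-vanishes : ∀ m x y k → m < 2 ℕ.* k → rhsTerm m x y k ≡ 0ℚ
rhsTerm-vanishes m x y k m<2k = begin
  catalan k * ι (m C (2 ℕ.* k)) * pow x k * p ≡⟨ cong (λ c → catalan k * ι c * pow x k * p) (k>n⇒nCk≡0 m<2k) ⟩
  catalan k * 0ℚ * pow x k * p                ≡⟨ solve 3 (λ c x′ p → c :* con 0ℚ :* x′ :* p := con 0ℚ) refl (catalan k) (pow x k) p ⟩
  0ℚ                                          ∎
  where
  p = pow (1ℚ + y) (suc m ∸ 2 ℕ.* k ∸ 1)

lhs-row≡rhsTerm : ∀ m x y k →
  sumFrom 0 (suc m ℕ.+ 2 ∸ 2 ℕ.* suc k) (lhsTerm m x y (suc k)) ≡ rhsTerm m x y k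
lhs-row≡rhsTerm m x y k rewrite [n+2]∸2[1+k]≡n∸2k (suc m) k with 2 ℕ.* k ℕ.≤? m
... | no 2k≰m = trans (cong (λ c → sumFrom 0 c (lhsTerm m x y (suc k))) (ℕ.m≤n⇒m∸n≡0 m<2k))
                      (sym (rhsTerm-vanishes m x y k m<2k))
  where
  m<2k = ℕ.≰⇒> 2k≰m
... | yes 2k≤m = begin
  sumFrom 0 (suc m ∸ 2 ℕ.* k) (lhsTerm m x y (suc k))
    ≡⟨ cong (λ c → sumFrom 0 c (lhsTerm m x y (suc k))) 1+m∸2k≡1+r ⟩
  sumFrom 0 (suc r) (lhsTerm m x y (suc k))
    ≡⟨ sumFrom-cong 0 (suc r) (λ j _ j<1+r → lhsTerm-factor m x y k j (2k+j≤m (ℕ.≤-pred j<1+r))) ⟩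
  sumFrom 0 (suc r) (λ j → P * binomialTerm y r j)
    ≡⟨ *-distribˡ-sumFrom P 0 (suc r) (binomialTerm y r) ⟨
  P * sumFrom 0 (suc r) (binomialTerm y r)
    ≡⟨ cong (P *_) (binomial-theorem y r) ⟨
  P * pow (1ℚ + y) r
    ≡⟨ cong (λ e → P * pow (1ℚ + y) (e ∸ 1)) 1+m∸2k≡1+r ⟨
  rhsTerm m x y k ∎
  where
  r = m ∸ 2 ℕ.* k
  P = catalan k * ι (m C (2 ℕ.* k)) * pow x k
  1+m∸2k≡1+r : suc m ∸ 2 ℕ.* k ≡ suc r
  1+m∸2k≡1+r = ℕ.+-∸-assoc 1 2k≤m
  2k+j≤m : ∀ {j} → j ℕ.≤ r → 2 ℕ.* k ℕ.+ j ℕ.≤ m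
  2k+j≤m j≤r = ℕ.≤-trans (ℕ.+-monoʳ-≤ (2 ℕ.* k) j≤r) (ℕ.≤-reflexive (ℕ.m+[n∸m]≡n 2k≤m))

mainTheorem9 : (n : ℕ) → (1≤n : 1 ≤ n) → (x y : ℚ) →
    lhs n {{>-nonZero 1≤n}} x y ≡ rhs n x y
mainTheorem9 (suc m) (s≤s z≤n) x y = begin
  lhs (suc m) x y
    ≡⟨ sumFrom-suc 0 (suc m) (λ i → sumFrom 0 (suc m ℕ.+ 2 ∸ 2 ℕ.* i) (lhsTerm m x y i)) ⟩
  sumFrom 0 (suc m) (λ k → sumFrom 0 (suc m ℕ.+ 2 ∸ 2 ℕ.* suc k) (lhsTerm m x y (suc k)))
    ≡⟨ sumFrom-cong 0 (suc m) (λ k _ _ → lhs-row≡rhsTerm m x y k) ⟩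
  sumFrom 0 (suc m) (rhsTerm m x y)
    ≡⟨ sumFrom-vanishing 0 (rhsTerm m x y) (s≤s (m/n≤m m 2)) rhsTerm-beyond-m/2 ⟩
  rhs (suc m) x y ∎
  where
  rhsTerm-beyond-m/2 : ∀ k → suc (m ℕ./ 2) ℕ.≤ k → rhsTerm m x y k ≡ 0ℚ
  rhsTerm-beyond-m/2 k 1+m/2≤k = rhsTerm-vanishes m x y k (ℕ.<-≤-trans (m<2*[1+m/2] m) (ℕ.*-monoʳ-≤ 2 1+m/2≤k))
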